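{- Let $p\geq 2$ and $j$ be integers, and let $x$ denote a square root of $j+2$ (in $\mathbb{C}$). Then for all integers $k$ (for which the denominators below are nonzero) $$ s_k(\mathcal{T}_p(j)) = R_k(j)\, s_k(j), \qquad R_k(j)=\frac{\mathcal{U}_{p-1}\big(\mathcal{T}_{2k+1}(x)\big)}{\mathcal{U}_{p-1}(x)}\in\mathbb{Q}, $$ and the sequence $(R_k(j))_{k}$ satisfies a linear recurrence of order $p$ with constant coefficients. In particular, for $p=2$ one has $R_k(j)=r_k(j)\in\mathbb{Z}$, while for every odd $p$ $$ R_k(j)=\frac{s_{(p-1)/2}\big(\mathcal{T}_{2k+1}(j)\big)}{s_{(p-1)/2}(j)}\in\mathbb{Q} $$ and $$ (\mathrm{S}-1)\prod_{i=1}^{(p-1)/2}\big(\mathrm{S}^2-\mathcal{T}_{2i}(j)\,\mathrm{S}+1\big)\, R_k(j)=0, $$ where $\mathrm{S}$ is the forward shift $\mathrm{S}\,f_k=f_{k+1}$ in the index $k$.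
   Context: For a number $n$, the sequence $(s_k(n))_{k\in\mathbb{Z}}$ is defined by $s_0(n)=1$, $s_1(n)=n+1$, $s_{k+2}(n)=n\,s_{k+1}(n)-s_k(n)$ for all $k\in\mathbb{Z}$, and $(r_k(n))_{k\in\mathbb{Z}}$ by $r_0(n)=1$, $r_1(n)=n-1$, $r_{k+2}(n)=n\,r_{k+1}(n)-r_k(n)$. The dilated Chebyshev polynomials $\mathcal{T}_k,\mathcal{U}_k$ ($k\in\mathbb{Z}$) are defined by $\mathcal{T}_k(2\cos\theta)=2\cos(k\theta)$ and $\mathcal{U}_k(2\cos\theta)=\sin((k+1)\theta)/\sin\theta$; equivalently both satisfy $y_{k+2}=x\,y_{k+1}-y_k$ with $\mathcal{T}_0=2,\mathcal{T}_1(x)=x$ and $\mathcal{U}_0=1,\mathcal{U}_1(x)=x$. -}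

module Defs where

open import Data.Nat as ℕ using (ℕ; zero; suc)
open import Data.Integer as ℤ using (ℤ; +_; -[1+_])
open import Data.Rational as ℚ using (ℚ)
open import Data.Sign using (Sign)
open import Data.List using (List; []; _∷_; map)
open import Data.Product using (_×_; _,_)
open import Relation.Binary.PropositionalEquality using (_≡_)

module TwoSided {A : Set} (_⊕_ : A → A → A) (_⊗_ : A → A → A) (⊖_ : A → A) where

  lin : A → A → A → ℕ → A
  lin c u0 u1 zero    = u0
  lin c u0 u1 (suc t) = lin c u1 ((c ⊗ u1) ⊕ (⊖ u0)) t

  -- the unique two-sided extension, y_k for k ∈ ℤ.
  -- For negative k we run the same recurrence backwards:
  -- y_{-1} = c y_0 - y_1, and (y_{-t})_t satisfies the same recurrence.
  biseq : A → A → A → ℤ → A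
  biseq c u0 u1 (+ t)      = lin c u0 u1 t
  biseq c u0 u1 -[1+ t ]   = lin c u0 ((c ⊗ u0) ⊕ (⊖ u1)) (suc t)

open TwoSided ℤ._+_ ℤ._*_ ℤ.-_ public
  renaming (lin to linℤ; biseq to biseqℤ)

s : ℤ → ℤ → ℤ
s k n = biseqℤ n (+ 1) (n ℤ.+ + 1) k

r : ℤ → ℤ → ℤ
r k n = biseqℤ n (+ 1) (n ℤ.- + 1) k

𝒯 : ℤ → ℤ → ℤ
𝒯 k y = biseqℤ y (+ 2) y k

𝒰 : ℤ → ℤ → ℤ
𝒰 k y = biseqℤ y (+ 1) y k

-- The ring ℤ[x]/(x² - m): a pair (a , b) stands for a + b x.

ℤx : Set
ℤx = ℤ × ℤ

module ZX (m : ℤ) where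
  _⊕_ : ℤx → ℤx → ℤx
  (a , b) ⊕ (c , d) = (a ℤ.+ c , b ℤ.+ d)

  _⊗_ : ℤx → ℤx → ℤx
  (a , b) ⊗ (c , d) = (a ℤ.* c ℤ.+ m ℤ.* (b ℤ.* d) , a ℤ.* d ℤ.+ b ℤ.* c)

  ⊖_ : ℤx → ℤx
  ⊖ (a , b) = (ℤ.- a , ℤ.- b)

  open TwoSided _⊕_ _⊗_ ⊖_ public

  xgen : ℤx
  xgen = (+ 0 , + 1)

  𝒯x : ℤ → ℤx → ℤx
  𝒯x k y = biseq y (+ 2 , + 0) y k

  𝒰x : ℤ → ℤx → ℤx
  𝒰x k y = biseq y (+ 1 , + 0) y k

-- Let √m denote the principal complex square root
-- of the integer m (√m ≥ 0 if m ≥ 0, √m = i√|m| if m < 0), and let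
-- x = ε √m for a sign ε.  For rationals α, β:
--     α + β x = 0 in ℂ   ⇔   α² = β² m  and  ε·αβ ≤ 0.
-- (If m < 0 the first equation forces α = β = 0.)
-- We take this as the definition of "α + β x = 0 in ℂ".

ℤtoℚ : ℤ → ℚ
ℤtoℚ z = z ℚ./ 1

IsZeroℂ : Sign → ℤ → ℚ → ℚ → Set
IsZeroℂ Sign.+ m α β = (α ℚ.* α ≡ (β ℚ.* β) ℚ.* ℤtoℚ m) × (α ℚ.* β) ℚ.≤ ℚ.0ℚ
IsZeroℂ Sign.- m α β = (α ℚ.* α ≡ (β ℚ.* β) ℚ.* ℤtoℚ m) × ℚ.0ℚ ℚ.≤ (α ℚ.* β)

IsZeroℤx : Sign → ℤ → ℤx → Set
IsZeroℤx ε m (a , b) = IsZeroℂ ε m (ℤtoℚ a) (ℤtoℚ b)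

MulEqℂ : Sign → ℤ → ℚ → ℤx → ℤx → Set
MulEqℂ ε m q (a , b) (c , d) =
  IsZeroℂ ε m (q ℚ.* ℤtoℚ a ℚ.- ℤtoℚ c) (q ℚ.* ℤtoℚ b ℚ.- ℤtoℚ d)

-- Polynomials in the shift operator S, as coefficient lists
-- (lowest degree first), acting on sequences ℤ → ℚ.

applyOp : List ℚ → (ℤ → ℚ) → ℤ → ℚ
applyOp []       f k = ℚ.0ℚ
applyOp (c ∷ cs) f k = c ℚ.* f k ℚ.+ applyOp cs f (k ℤ.+ + 1)

_+P_ : List ℤ → List ℤ → List ℤ
[]       +P q        = q
(a ∷ p)  +P []       = a ∷ p
(a ∷ p)  +P (b ∷ q)  = (a ℤ.+ b) ∷ (p +P q)

_*P_ : List ℤ → List ℤ → List ℤ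
[]      *P q = []
(a ∷ p) *P q = map (a ℤ.*_) q +P (+ 0 ∷ (p *P q))

prodFactors : ℕ → ℤ → List ℤ
prodFactors zero    j = + 1 ∷ []
prodFactors (suc i) j =
  (+ 1 ∷ ℤ.- 𝒯 (+ (2 ℕ.* suc i)) j ∷ + 1 ∷ []) *P prodFactors i j

annihilator : ℕ → ℤ → List ℤ
annihilator m j = (ℤ.- + 1 ∷ + 1 ∷ []) *P prodFactors m j

{-# OPTIONS --safe #-}
module Submission where

-- Work in ℤ[x]/(x² − (j + 2)), where 𝒯₂(x) = j.  Since s_k(𝒯₂ y) = 𝒰_{2k}(y) and
-- 𝒯_p(j) = 𝒯₂(𝒯_p x), the identity 𝒰_{a−1}(𝒯_b y) 𝒰_{b−1}(y) = 𝒰_{ab−1}(y), used with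
-- (a, b) = (2k + 1, p) and (p, 2k + 1), gives
--   s_k(𝒯_p j) 𝒰_{p−1}(x) = 𝒰_{p−1}(𝒯_{2k+1} x) s_k(j).
-- Both 𝒰_{p−1}(x) and 𝒰_{p−1}(𝒯_{2k+1} x) are integer multiples of 1 (p odd) or of x
-- (p even), so their ratio R_k is rational.  Finally 𝒰_{p−1} is 1 + 𝒯₂ + ⋯ + 𝒯_{p−1} or
-- 𝒯₁ + 𝒯₃ + ⋯ + 𝒯_{p−1}, and k ↦ 𝒯_q(𝒯_{2k+1} x) satisfies y_{k+1} + y_{k−1} = 𝒯_q(j) y_k,
-- so a product of the factors S² − 𝒯_q(j) S + 1 (and S − 1 for the constant term)
-- annihilates R.

open import Defs
open import Algebra using (CommutativeRing; IsCommutativeRing; Op₁; Op₂)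
open import Level using (0ℓ)
open import Data.Nat as ℕ using (ℕ; zero; suc; _≤_)
open import Data.Integer as ℤ using (ℤ; +_; -[1+_])
open import Data.Integer.Tactic.RingSolver using (solve-∀)
open import Data.Product using (Σ; _×_; _,_; proj₁; proj₂)
open import Relation.Binary.PropositionalEquality
open import Relation.Nullary using (¬_)
open import Data.Empty using (⊥-elim)
open import Function using (case_of_)
open import Data.Rational as ℚ using (ℚ; mkℚ)
import Data.Rational.Properties as ℚP
import Data.Nat.Coprimality as NC
open import Data.Sign using (Sign)
open import Data.List using (List; []; _∷_; _++_; length; map)
import Data.Integer.Properties as ℤP
import Data.Nat.Properties as ℕP
import Data.List.Properties as LP

open ≡-Reasoning

module Chebyshev
  {A : Set} {add mul : Op₂ A} {neg : Op₁ A} {0ᴬ 1ᴬ : A}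
  (isCommutativeRing : IsCommutativeRing _≡_ add mul neg 0ᴬ 1ᴬ) where

  commutativeRing : CommutativeRing 0ℓ 0ℓ
  commutativeRing = record { isCommutativeRing = isCommutativeRing }

  open CommutativeRing commutativeRing
    hiding (refl; sym; trans; isCommutativeRing)
  open import Algebra.Properties.Ring ring
    using (+-cancelˡ; +-cancelʳ; //-rightDividesˡ; -‿+-comm; [y-z]x≈yx-zx)
  open import Algebra.Properties.CommutativeSemigroup +-commutativeSemigroup
    using (interchange)
  open TwoSided _+_ _*_ -_ public

  Recurrent : A → (ℤ → A) → Set
  Recurrent c f = ∀ k → f (ℤ.suc k) + f (ℤ.pred k) ≡ c * f k

  private
    [x-y]+y≡x : ∀ x y → (x - y) + y ≡ x
    [x-y]+y≡x x y = //-rightDividesˡ y x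

    x+[y-x]≡y : ∀ x y → x + (y - x) ≡ y
    x+[y-x]≡y x y = trans (+-comm x (y - x)) ([x-y]+y≡x y x)

  lin-step : ∀ c u₀ u₁ t →
    lin c u₀ u₁ (suc (suc t)) ≡ c * lin c u₀ u₁ (suc t) - lin c u₀ u₁ t
  lin-step c u₀ u₁ zero    = refl
  lin-step c u₀ u₁ (suc t) = lin-step c u₁ (c * u₁ - u₀) t

  biseq-recurrent : ∀ c u₀ u₁ → Recurrent c (biseq c u₀ u₁)
  biseq-recurrent c u₀ u₁ (+ zero) = x+[y-x]≡y u₁ (c * u₀)
  biseq-recurrent c u₀ u₁ (+ suc t) =
    trans (cong (_+ lin c u₀ u₁ t) (lin-step c u₀ u₁ t)) ([x-y]+y≡x _ _)
  biseq-recurrent c u₀ u₁ -[1+ zero ] = x+[y-x]≡y u₀ (c * (c * u₀ - u₁))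
  biseq-recurrent c u₀ u₁ -[1+ suc t ] =
    trans (cong (λ z → L (suc t) + z) (lin-step c u₀ v (suc t))) (x+[y-x]≡y _ _)
    where
    v = c * u₀ - u₁
    L = lin c u₀ v

  recurrent-unique : ∀ {c f g} → Recurrent c f → Recurrent c g →
    f (+ 0) ≡ g (+ 0) → f (+ 1) ≡ g (+ 1) → ∀ k → f k ≡ g k
  recurrent-unique {c} {f} {g} rf rg e₀ e₁ = agree
    where
    forward : ∀ k → f k ≡ g k → f (ℤ.pred k) ≡ g (ℤ.pred k) →
      f (ℤ.suc k) ≡ g (ℤ.suc k)
    forward k eq eq₋ = +-cancelʳ (f (ℤ.pred k)) _ _ (begin
      f (ℤ.suc k) + f (ℤ.pred k) ≡⟨ rf k ⟩
      c * f k                     ≡⟨ cong (c *_) eq ⟩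
      c * g k                     ≡⟨ sym (rg k) ⟩
      g (ℤ.suc k) + g (ℤ.pred k) ≡⟨ cong (λ z → g (ℤ.suc k) + z) (sym eq₋) ⟩
      g (ℤ.suc k) + f (ℤ.pred k) ∎)

    backward : ∀ k → f k ≡ g k → f (ℤ.suc k) ≡ g (ℤ.suc k) →
      f (ℤ.pred k) ≡ g (ℤ.pred k)
    backward k eq eq₊ = +-cancelˡ (f (ℤ.suc k)) _ _ (begin
      f (ℤ.suc k) + f (ℤ.pred k) ≡⟨ rf k ⟩
      c * f k                     ≡⟨ cong (c *_) eq ⟩
      c * g k                     ≡⟨ sym (rg k) ⟩
      g (ℤ.suc k) + g (ℤ.pred k) ≡⟨ cong (_+ g (ℤ.pred k)) (sym eq₊) ⟩
      f (ℤ.suc k) + g (ℤ.pred k) ∎)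

    nonnegative : ∀ t → f (+ t) ≡ g (+ t) × f (+ suc t) ≡ g (+ suc t)
    nonnegative zero    = e₀ , e₁
    nonnegative (suc t) with nonnegative t
    ... | eq₋ , eq = eq , forward (+ suc t) eq eq₋

    negative : ∀ t → f -[1+ t ] ≡ g -[1+ t ] × f (ℤ.suc -[1+ t ]) ≡ g (ℤ.suc -[1+ t ])
    negative zero    = backward (+ 0) e₀ e₁ , e₀
    negative (suc t) with negative t
    ... | eq , eq₊ = backward -[1+ t ] eq eq₊ , eq

    agree : ∀ k → f k ≡ g k
    agree (+ t)     = proj₁ (nonnegative t)
    agree -[1+ t ]  = proj₁ (negative t)

  recurrent-+ : ∀ {c f g} → Recurrent c f → Recurrent c g →
    Recurrent c (λ k → f k + g k)
  recurrent-+ {c} {f} {g} rf rg k = begin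
    (f (ℤ.suc k) + g (ℤ.suc k)) + (f (ℤ.pred k) + g (ℤ.pred k))
      ≡⟨ interchange _ _ _ _ ⟩
    (f (ℤ.suc k) + f (ℤ.pred k)) + (g (ℤ.suc k) + g (ℤ.pred k))
      ≡⟨ cong₂ _+_ (rf k) (rg k) ⟩
    c * f k + c * g k
      ≡⟨ sym (distribˡ c (f k) (g k)) ⟩
    c * (f k + g k) ∎

  recurrent-*ʳ : ∀ {c f} a → Recurrent c f → Recurrent c (λ k → f k * a)
  recurrent-*ʳ {c} {f} a rf k = begin
    f (ℤ.suc k) * a + f (ℤ.pred k) * a ≡⟨ sym (distribʳ a _ _) ⟩
    (f (ℤ.suc k) + f (ℤ.pred k)) * a   ≡⟨ cong (_* a) (rf k) ⟩
    c * f k * a                         ≡⟨ *-assoc c (f k) a ⟩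
    c * (f k * a)                       ∎

  recurrent-shift : ∀ {c f} n → Recurrent c f → Recurrent c (λ k → f (k ℤ.+ n))
  recurrent-shift {c} {f} n rf k = begin
    f (ℤ.suc k ℤ.+ n) + f (ℤ.pred k ℤ.+ n)
      ≡⟨ cong₂ (λ a b → f a + f b) (suc-shift k n) (pred-shift k n) ⟩
    f (ℤ.suc (k ℤ.+ n)) + f (ℤ.pred (k ℤ.+ n))
      ≡⟨ rf (k ℤ.+ n) ⟩
    c * f (k ℤ.+ n) ∎
    where
    suc-shift : ∀ k n → (+ 1 ℤ.+ k) ℤ.+ n ≡ + 1 ℤ.+ (k ℤ.+ n)
    suc-shift = solve-∀
    pred-shift : ∀ k n → (-[1+ 0 ] ℤ.+ k) ℤ.+ n ≡ -[1+ 0 ] ℤ.+ (k ℤ.+ n)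
    pred-shift = solve-∀

  recurrent-reflect : ∀ {c f} n → Recurrent c f → Recurrent c (λ k → f (n ℤ.- k))
  recurrent-reflect {c} {f} n rf k = begin
    f (n ℤ.- ℤ.suc k) + f (n ℤ.- ℤ.pred k)
      ≡⟨ cong₂ (λ a b → f a + f b) (minus-suc n k) (minus-pred n k) ⟩
    f (ℤ.pred (n ℤ.- k)) + f (ℤ.suc (n ℤ.- k))
      ≡⟨ +-comm _ _ ⟩
    f (ℤ.suc (n ℤ.- k)) + f (ℤ.pred (n ℤ.- k))
      ≡⟨ rf (n ℤ.- k) ⟩
    c * f (n ℤ.- k) ∎
    where
    minus-suc : ∀ n k → n ℤ.- (+ 1 ℤ.+ k) ≡ -[1+ 0 ] ℤ.+ (n ℤ.- k)
    minus-suc = solve-∀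
    minus-pred : ∀ n k → n ℤ.- (-[1+ 0 ] ℤ.+ k) ≡ + 1 ℤ.+ (n ℤ.- k)
    minus-pred = solve-∀

  T U : ℤ → A → A
  T n y = biseq y (1# + 1#) y n
  U n y = biseq y 1# y n

  T-recurrent : ∀ y → Recurrent y (λ n → T n y)
  T-recurrent y = biseq-recurrent y (1# + 1#) y

  U-recurrent : ∀ y → Recurrent y (λ n → U n y)
  U-recurrent y = biseq-recurrent y 1# y

  U₋₁≡0 : ∀ y → U -[1+ 0 ] y ≡ 0#
  U₋₁≡0 y = trans (cong (_- y) (*-identityʳ y)) (-‿inverseʳ y)

  T-*-recurrent : ∀ {y B} → Recurrent y B →
    ∀ a n → T a y * B n ≡ B (n ℤ.+ a) + B (n ℤ.- a)
  T-*-recurrent {y} {B} rB a n = begin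
    T a y * B n                     ≡⟨ recurrent-unique
                                         (recurrent-*ʳ (B n) (T-recurrent y))
                                         (recurrent-+ (recurrent-shift n rB) (recurrent-reflect n rB))
                                         at-0 at-1 a ⟩
    B (a ℤ.+ n) + B (n ℤ.- a)       ≡⟨ cong (λ i → B i + B (n ℤ.- a)) (ℤP.+-comm a n) ⟩
    B (n ℤ.+ a) + B (n ℤ.- a)       ∎
    where
    at-0 : (1# + 1#) * B n ≡ B (+ 0 ℤ.+ n) + B (n ℤ.- + 0)
    at-0 = begin
      (1# + 1#) * B n        ≡⟨ distribʳ (B n) 1# 1# ⟩
      1# * B n + 1# * B n    ≡⟨ cong₂ _+_ (*-identityˡ (B n)) (*-identityˡ (B n)) ⟩
      B n + B n              ≡⟨ cong₂ (λ i j → B i + B j) (sym (ℤP.+-identityˡ n)) (sym (ℤP.+-identityʳ n)) ⟩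
      B (+ 0 ℤ.+ n) + B (n ℤ.- + 0) ∎
    at-1 : y * B n ≡ B (+ 1 ℤ.+ n) + B (n ℤ.- + 1)
    at-1 = trans (sym (rB n)) (cong (λ i → B (ℤ.suc n) + B i) (ℤP.+-comm -[1+ 0 ] n))

  recurrent-arith : ∀ {y B} → Recurrent y B →
    ∀ a b → Recurrent (T a y) (λ k → B (a ℤ.* k ℤ.+ b))
  recurrent-arith {y} {B} rB a b k = begin
    B (a ℤ.* ℤ.suc k ℤ.+ b) + B (a ℤ.* ℤ.pred k ℤ.+ b)
      ≡⟨ cong₂ (λ i j → B i + B j) (step-up a b k) (step-down a b k) ⟩
    B ((a ℤ.* k ℤ.+ b) ℤ.+ a) + B ((a ℤ.* k ℤ.+ b) ℤ.- a)
      ≡⟨ sym (T-*-recurrent rB a (a ℤ.* k ℤ.+ b)) ⟩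
    T a y * B (a ℤ.* k ℤ.+ b) ∎
    where
    step-up : ∀ a b k → a ℤ.* (+ 1 ℤ.+ k) ℤ.+ b ≡ (a ℤ.* k ℤ.+ b) ℤ.+ a
    step-up = solve-∀
    step-down : ∀ a b k → a ℤ.* (-[1+ 0 ] ℤ.+ k) ℤ.+ b ≡ (a ℤ.* k ℤ.+ b) ℤ.- a
    step-down = solve-∀

  T-∘ : ∀ a b y → T a (T b y) ≡ T (a ℤ.* b) y
  T-∘ a b y = begin
    T a (T b y)           ≡⟨ recurrent-unique (T-recurrent (T b y))
                               (recurrent-arith (T-recurrent y) b (+ 0))
                               (cong (λ i → T i y) (sym (trans (ℤP.+-identityʳ (b ℤ.* + 0)) (ℤP.*-zeroʳ b))))
                               (cong (λ i → T i y) (sym (trans (ℤP.+-identityʳ (b ℤ.* + 1)) (ℤP.*-identityʳ b))))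
                               a ⟩
    T (b ℤ.* a ℤ.+ + 0) y ≡⟨ cong (λ i → T i y) (trans (ℤP.+-identityʳ (b ℤ.* a)) (ℤP.*-comm b a)) ⟩
    T (a ℤ.* b) y         ∎

  U-∘ : ∀ a b y → U (a ℤ.- + 1) (T b y) * U (b ℤ.- + 1) y ≡ U (a ℤ.* b ℤ.- + 1) y
  U-∘ a b y = begin
    U (a ℤ.- + 1) (T b y) * U (b ℤ.- + 1) y
      ≡⟨ recurrent-unique
           (recurrent-*ʳ (U (b ℤ.- + 1) y) (recurrent-shift -[1+ 0 ] (U-recurrent (T b y))))
           (recurrent-arith (U-recurrent y) b -[1+ 0 ])
           at-0 at-1 a ⟩
    U (b ℤ.* a ℤ.- + 1) y
      ≡⟨ cong (λ i → U (i ℤ.- + 1) y) (ℤP.*-comm b a) ⟩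
    U (a ℤ.* b ℤ.- + 1) y ∎
    where
    at-0 : U -[1+ 0 ] (T b y) * U (b ℤ.- + 1) y ≡ U (b ℤ.* + 0 ℤ.- + 1) y
    at-0 = begin
      U -[1+ 0 ] (T b y) * U (b ℤ.- + 1) y ≡⟨ cong (_* U (b ℤ.- + 1) y) (U₋₁≡0 (T b y)) ⟩
      0# * U (b ℤ.- + 1) y                 ≡⟨ zeroˡ _ ⟩
      0#                                   ≡⟨ sym (U₋₁≡0 y) ⟩
      U -[1+ 0 ] y                         ≡⟨ cong (λ i → U (i ℤ.- + 1) y) (sym (ℤP.*-zeroʳ b)) ⟩
      U (b ℤ.* + 0 ℤ.- + 1) y              ∎
    at-1 : 1# * U (b ℤ.- + 1) y ≡ U (b ℤ.* + 1 ℤ.- + 1) y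
    at-1 = trans (*-identityˡ _) (cong (λ i → U (i ℤ.- + 1) y) (sym (ℤP.*-identityʳ b)))

  U-∘-swap : ∀ a b y →
    U (a ℤ.- + 1) (T b y) * U (b ℤ.- + 1) y ≡ U (b ℤ.- + 1) (T a y) * U (a ℤ.- + 1) y
  U-∘-swap a b y = begin
    U (a ℤ.- + 1) (T b y) * U (b ℤ.- + 1) y ≡⟨ U-∘ a b y ⟩
    U (a ℤ.* b ℤ.- + 1) y                   ≡⟨ cong (λ i → U (i ℤ.- + 1) y) (ℤP.*-comm a b) ⟩
    U (b ℤ.* a ℤ.- + 1) y                   ≡⟨ sym (U-∘ b a y) ⟩
    U (b ℤ.- + 1) (T a y) * U (a ℤ.- + 1) y ∎

  U-even : ∀ k y → biseq (T (+ 2) y) 1# (T (+ 2) y + 1#) k ≡ U (+ 2 ℤ.* k) y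
  U-even k y = trans
    (recurrent-unique (biseq-recurrent _ _ _) (recurrent-arith (U-recurrent y) (+ 2) (+ 0)) refl T₂+1≡U₂ k)
    (cong (λ i → U i y) (ℤP.+-identityʳ (+ 2 ℤ.* k)))
    where
    T₂+1≡U₂ : T (+ 2) y + 1# ≡ U (+ 2) y
    T₂+1≡U₂ = begin
      (y * y - (1# + 1#)) + 1#        ≡⟨ +-assoc (y * y) _ 1# ⟩
      y * y + (- (1# + 1#) + 1#)      ≡⟨ cong (λ z → y * y + (z + 1#)) (sym (-‿+-comm 1# 1#)) ⟩
      y * y + ((- 1# + - 1#) + 1#)    ≡⟨ cong (λ z → y * y + z) ([x-y]+y≡x (- 1#) 1#) ⟩
      y * y - 1#                      ∎

  T-odd : ∀ k y → biseq (T (+ 2) y) 1# (T (+ 2) y - 1#) k * y ≡ T (+ 2 ℤ.* k ℤ.+ + 1) y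
  T-odd k y = recurrent-unique
    (recurrent-*ʳ y (biseq-recurrent _ _ _)) (recurrent-arith (T-recurrent y) (+ 2) (+ 1))
    (*-identityˡ y) at-1 k
    where
    at-1 : (T (+ 2) y - 1#) * y ≡ T (+ 3) y
    at-1 = begin
      (T (+ 2) y - 1#) * y     ≡⟨ [y-z]x≈yx-zx y (T (+ 2) y) 1# ⟩
      T (+ 2) y * y - 1# * y   ≡⟨ cong₂ _-_ (*-comm (T (+ 2) y) y) (*-identityˡ y) ⟩
      y * T (+ 2) y - y        ∎

  U-split : ∀ n y → U n y ≡ T n y + U (n ℤ.- + 2) y
  U-split n y = recurrent-unique
    (U-recurrent y) (recurrent-+ (T-recurrent y) (recurrent-shift -[1+ 1 ] (U-recurrent y)))
    at-0 at-1 n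
    where
    at-0 : 1# ≡ (1# + 1#) + (y * U -[1+ 0 ] y - 1#)
    at-0 = sym (begin
      (1# + 1#) + (y * U -[1+ 0 ] y - 1#) ≡⟨ cong (λ z → (1# + 1#) + (y * z - 1#)) (U₋₁≡0 y) ⟩
      (1# + 1#) + (y * 0# - 1#)           ≡⟨ cong (λ z → (1# + 1#) + (z - 1#)) (zeroʳ y) ⟩
      (1# + 1#) + (0# - 1#)               ≡⟨ cong (λ z → (1# + 1#) + z) (+-identityˡ (- 1#)) ⟩
      (1# + 1#) - 1#                      ≡⟨ +-assoc 1# 1# (- 1#) ⟩
      1# + (1# - 1#)                      ≡⟨ cong (λ z → 1# + z) (-‿inverseʳ 1#) ⟩
      1# + 0#                             ≡⟨ +-identityʳ 1# ⟩
      1#                                  ∎)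
    at-1 : y ≡ y + U -[1+ 0 ] y
    at-1 = sym (trans (cong (λ z → y + z) (U₋₁≡0 y)) (+-identityʳ y))

  T-∘-comm : ∀ a b y → T a (T b y) ≡ T b (T a y)
  T-∘-comm a b y = begin
    T a (T b y)   ≡⟨ T-∘ a b y ⟩
    T (a ℤ.* b) y ≡⟨ cong (λ i → T i y) (ℤP.*-comm a b) ⟩
    T (b ℤ.* a) y ≡⟨ sym (T-∘ b a y) ⟩
    T b (T a y)   ∎

  T-∘-recurrent : ∀ q a b y → Recurrent (T q (T a y)) (λ k → T q (T (a ℤ.* k ℤ.+ b) y))
  T-∘-recurrent q a b y k = begin
    T q (T (a ℤ.* ℤ.suc k ℤ.+ b) y) + T q (T (a ℤ.* ℤ.pred k ℤ.+ b) y)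
      ≡⟨ cong₂ _+_ (T-∘′ (ℤ.suc k)) (T-∘′ (ℤ.pred k)) ⟩
    T (q ℤ.* a ℤ.* ℤ.suc k ℤ.+ q ℤ.* b) y + T (q ℤ.* a ℤ.* ℤ.pred k ℤ.+ q ℤ.* b) y
      ≡⟨ recurrent-arith (T-recurrent y) (q ℤ.* a) (q ℤ.* b) k ⟩
    T (q ℤ.* a) y * T (q ℤ.* a ℤ.* k ℤ.+ q ℤ.* b) y
      ≡⟨ cong₂ _*_ (sym (T-∘ q a y)) (sym (T-∘′ k)) ⟩
    T q (T a y) * T q (T (a ℤ.* k ℤ.+ b) y) ∎
    where
    distrib-index : ∀ q a b k → q ℤ.* (a ℤ.* k ℤ.+ b) ≡ q ℤ.* a ℤ.* k ℤ.+ q ℤ.* b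
    distrib-index = solve-∀
    T-∘′ : ∀ k → T q (T (a ℤ.* k ℤ.+ b) y) ≡ T (q ℤ.* a ℤ.* k ℤ.+ q ℤ.* b) y
    T-∘′ k = trans (T-∘ q _ y) (cong (λ i → T i y) (distrib-index q a b k))

module _ {A B : Set}
  {addᴬ mulᴬ : Op₂ A} {negᴬ : Op₁ A} {addᴮ mulᴮ : Op₂ B} {negᴮ : Op₁ B}
  (φ : A → B)
  (φ-step : ∀ c u₀ u₁ → φ (addᴬ (mulᴬ c u₁) (negᴬ u₀)) ≡ addᴮ (mulᴮ (φ c) (φ u₁)) (negᴮ (φ u₀)))
  where
  private
    module Sᴬ = TwoSided addᴬ mulᴬ negᴬ
    module Sᴮ = TwoSided addᴮ mulᴮ negᴮ

  lin-map : ∀ c u₀ u₁ t → φ (Sᴬ.lin c u₀ u₁ t) ≡ Sᴮ.lin (φ c) (φ u₀) (φ u₁) t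
  lin-map c u₀ u₁ zero    = refl
  lin-map c u₀ u₁ (suc t) = trans (lin-map c u₁ _ t) (cong (λ u → Sᴮ.lin (φ c) (φ u₁) u t) (φ-step c u₀ u₁))

  biseq-map : ∀ c u₀ u₁ k → φ (Sᴬ.biseq c u₀ u₁ k) ≡ Sᴮ.biseq (φ c) (φ u₀) (φ u₁) k
  biseq-map c u₀ u₁ (+ t)    = lin-map c u₀ u₁ t
  biseq-map c u₀ u₁ -[1+ t ] =
    trans (lin-map c u₀ _ (suc t)) (cong (λ u → Sᴮ.lin (φ c) (φ u₀) u (suc t)) (φ-step c u₁ u₀))

open Chebyshev ℤP.+-*-isCommutativeRing using () renaming (Recurrent to Recurrentℤ)

ℤtoℚ-mkℚ : ∀ a → ℤtoℚ a ≡ mkℚ a 0 (NC.sym (NC.1-coprimeTo ℤ.∣ a ∣))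
ℤtoℚ-mkℚ (+ n)    = ℚP.normalize-coprime (NC.sym (NC.1-coprimeTo n))
ℤtoℚ-mkℚ -[1+ n ] = cong ℚ.-_ (ℚP.normalize-coprime (NC.sym (NC.1-coprimeTo (suc n))))

ℤtoℚ-injective : ∀ {a b} → ℤtoℚ a ≡ ℤtoℚ b → a ≡ b
ℤtoℚ-injective {a} {b} eq = cong ℚ.↥_ (trans (sym (ℤtoℚ-mkℚ a)) (trans eq (ℤtoℚ-mkℚ b)))

ℤtoℚ-+ : ∀ a b → ℤtoℚ (a ℤ.+ b) ≡ ℤtoℚ a ℚ.+ ℤtoℚ b
ℤtoℚ-+ a b rewrite ℤtoℚ-mkℚ a | ℤtoℚ-mkℚ b =
  cong (ℚ._/ 1) (cong₂ ℤ._+_ (sym (ℤP.*-identityʳ a)) (sym (ℤP.*-identityʳ b)))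

ℤtoℚ-* : ∀ a b → ℤtoℚ (a ℤ.* b) ≡ ℤtoℚ a ℚ.* ℤtoℚ b
ℤtoℚ-* a b rewrite ℤtoℚ-mkℚ a | ℤtoℚ-mkℚ b = refl

IsZeroℂ-0 : ∀ ε m → IsZeroℂ ε m ℚ.0ℚ ℚ.0ℚ
IsZeroℂ-0 Sign.+ m = sym (ℚP.*-zeroˡ (ℤtoℚ m)) , ℚP.≤-refl
IsZeroℂ-0 Sign.- m = sym (ℚP.*-zeroˡ (ℤtoℚ m)) , ℚP.≤-refl

applyOpℤ : List ℤ → (ℤ → ℤ) → ℤ → ℤ
applyOpℤ []       f k = + 0
applyOpℤ (c ∷ cs) f k = c ℤ.* f k ℤ.+ applyOpℤ cs f (k ℤ.+ + 1)

Annihilates : List ℤ → (ℤ → ℤ) → Set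
Annihilates P f = ∀ k → applyOpℤ P f k ≡ + 0

applyOpℤ-cong : ∀ P {f g} → (∀ k → f k ≡ g k) → ∀ k → applyOpℤ P f k ≡ applyOpℤ P g k
applyOpℤ-cong []      eq k = refl
applyOpℤ-cong (c ∷ P) eq k = cong₂ (λ a b → c ℤ.* a ℤ.+ b) (eq k) (applyOpℤ-cong P eq (k ℤ.+ + 1))

applyOpℤ-zero : ∀ P k → applyOpℤ P (λ _ → + 0) k ≡ + 0
applyOpℤ-zero []      k = refl
applyOpℤ-zero (c ∷ P) k =
  trans (cong₂ ℤ._+_ (ℤP.*-zeroʳ c) (applyOpℤ-zero P (k ℤ.+ + 1))) refl

applyOpℤ-+ : ∀ P f g k → applyOpℤ P (λ k → f k ℤ.+ g k) k ≡ applyOpℤ P f k ℤ.+ applyOpℤ P g k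
applyOpℤ-+ []      f g k = refl
applyOpℤ-+ (c ∷ P) f g k =
  trans (cong (λ z → c ℤ.* (f k ℤ.+ g k) ℤ.+ z) (applyOpℤ-+ P f g (k ℤ.+ + 1))) (rearrange c (f k) (g k) _ _)
  where
  rearrange : ∀ c x y u v → c ℤ.* (x ℤ.+ y) ℤ.+ (u ℤ.+ v) ≡ (c ℤ.* x ℤ.+ u) ℤ.+ (c ℤ.* y ℤ.+ v)
  rearrange = solve-∀

applyOpℤ-scale : ∀ P a f k → applyOpℤ P (λ k → a ℤ.* f k) k ≡ a ℤ.* applyOpℤ P f k
applyOpℤ-scale []      a f k = sym (ℤP.*-zeroʳ a)
applyOpℤ-scale (c ∷ P) a f k =
  trans (cong (λ z → c ℤ.* (a ℤ.* f k) ℤ.+ z) (applyOpℤ-scale P a f (k ℤ.+ + 1))) (rearrange c a (f k) _)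
  where
  rearrange : ∀ c a x u → c ℤ.* (a ℤ.* x) ℤ.+ a ℤ.* u ≡ a ℤ.* (c ℤ.* x ℤ.+ u)
  rearrange = solve-∀

applyOpℤ-shift : ∀ P f k → applyOpℤ P (λ k → f (k ℤ.+ + 1)) k ≡ applyOpℤ P f (k ℤ.+ + 1)
applyOpℤ-shift []      f k = refl
applyOpℤ-shift (c ∷ P) f k = cong (λ z → c ℤ.* f (k ℤ.+ + 1) ℤ.+ z) (applyOpℤ-shift P f (k ℤ.+ + 1))

applyOpℤ-+P : ∀ P Q f k → applyOpℤ (P +P Q) f k ≡ applyOpℤ P f k ℤ.+ applyOpℤ Q f k
applyOpℤ-+P []      Q       f k = sym (ℤP.+-identityˡ _)
applyOpℤ-+P (a ∷ P) []      f k = sym (ℤP.+-identityʳ _)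
applyOpℤ-+P (a ∷ P) (b ∷ Q) f k =
  trans (cong (λ z → (a ℤ.+ b) ℤ.* f k ℤ.+ z) (applyOpℤ-+P P Q f (k ℤ.+ + 1))) (rearrange a b (f k) _ _)
  where
  rearrange : ∀ a b x u v → (a ℤ.+ b) ℤ.* x ℤ.+ (u ℤ.+ v) ≡ (a ℤ.* x ℤ.+ u) ℤ.+ (b ℤ.* x ℤ.+ v)
  rearrange = solve-∀

applyOpℤ-map-* : ∀ a Q f k → applyOpℤ (map (a ℤ.*_) Q) f k ≡ a ℤ.* applyOpℤ Q f k
applyOpℤ-map-* a []      f k = sym (ℤP.*-zeroʳ a)
applyOpℤ-map-* a (q ∷ Q) f k =
  trans (cong (λ z → a ℤ.* q ℤ.* f k ℤ.+ z) (applyOpℤ-map-* a Q f (k ℤ.+ + 1))) (rearrange a q (f k) _)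
  where
  rearrange : ∀ a q x u → a ℤ.* q ℤ.* x ℤ.+ a ℤ.* u ≡ a ℤ.* (q ℤ.* x ℤ.+ u)
  rearrange = solve-∀

applyOpℤ-*P : ∀ P Q f k → applyOpℤ (P *P Q) f k ≡ applyOpℤ P (applyOpℤ Q f) k
applyOpℤ-*P []      Q f k = refl
applyOpℤ-*P (a ∷ P) Q f k = begin
  applyOpℤ (map (a ℤ.*_) Q +P (+ 0 ∷ P *P Q)) f k
    ≡⟨ applyOpℤ-+P (map (a ℤ.*_) Q) (+ 0 ∷ P *P Q) f k ⟩
  applyOpℤ (map (a ℤ.*_) Q) f k ℤ.+ (+ 0 ℤ.* f k ℤ.+ applyOpℤ (P *P Q) f (k ℤ.+ + 1))
    ≡⟨ cong₂ (λ u v → u ℤ.+ (+ 0 ℤ.* f k ℤ.+ v)) (applyOpℤ-map-* a Q f k) (applyOpℤ-*P P Q f (k ℤ.+ + 1)) ⟩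
  a ℤ.* applyOpℤ Q f k ℤ.+ (+ 0 ℤ.* f k ℤ.+ applyOpℤ P (applyOpℤ Q f) (k ℤ.+ + 1))
    ≡⟨ cong (λ z → a ℤ.* applyOpℤ Q f k ℤ.+ z) (ℤP.+-identityˡ _) ⟩
  a ℤ.* applyOpℤ Q f k ℤ.+ applyOpℤ P (applyOpℤ Q f) (k ℤ.+ + 1) ∎

applyOpℤ-comm : ∀ P Q f k → applyOpℤ P (applyOpℤ Q f) k ≡ applyOpℤ Q (applyOpℤ P f) k
applyOpℤ-comm []      Q f k = sym (applyOpℤ-zero Q k)
applyOpℤ-comm (a ∷ P) Q f k = sym (begin
  applyOpℤ Q (λ k → a ℤ.* f k ℤ.+ applyOpℤ P f (k ℤ.+ + 1)) k
    ≡⟨ applyOpℤ-+ Q (λ k → a ℤ.* f k) (λ k → applyOpℤ P f (k ℤ.+ + 1)) k ⟩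
  applyOpℤ Q (λ k → a ℤ.* f k) k ℤ.+ applyOpℤ Q (λ k → applyOpℤ P f (k ℤ.+ + 1)) k
    ≡⟨ cong₂ ℤ._+_ (applyOpℤ-scale Q a f k) (applyOpℤ-shift Q (applyOpℤ P f) k) ⟩
  a ℤ.* applyOpℤ Q f k ℤ.+ applyOpℤ Q (applyOpℤ P f) (k ℤ.+ + 1)
    ≡⟨ cong (λ z → a ℤ.* applyOpℤ Q f k ℤ.+ z) (sym (applyOpℤ-comm P Q f (k ℤ.+ + 1))) ⟩
  a ℤ.* applyOpℤ Q f k ℤ.+ applyOpℤ P (applyOpℤ Q f) (k ℤ.+ + 1) ∎)

annihilates-*P-right : ∀ P Q {f} → Annihilates Q f → Annihilates (P *P Q) f
annihilates-*P-right P Q {f} ann k =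
  trans (applyOpℤ-*P P Q f k) (trans (applyOpℤ-cong P ann k) (applyOpℤ-zero P k))

annihilates-*P-left : ∀ P Q {f} → Annihilates P f → Annihilates (P *P Q) f
annihilates-*P-left P Q {f} ann k =
  trans (applyOpℤ-*P P Q f k)
    (trans (applyOpℤ-comm P Q f k) (trans (applyOpℤ-cong Q ann k) (applyOpℤ-zero Q k)))

annihilates-+ : ∀ {P f g} → Annihilates P f → Annihilates P g → Annihilates P (λ k → f k ℤ.+ g k)
annihilates-+ {P} {f} {g} ann-f ann-g k = trans (applyOpℤ-+ P f g k) (cong₂ ℤ._+_ (ann-f k) (ann-g k))

recurrenceOp : ℤ → List ℤ
recurrenceOp c = + 1 ∷ ℤ.- c ∷ + 1 ∷ []

annihilates-recurrenceOp : ∀ {c f} → Recurrentℤ c f → Annihilates (recurrenceOp c) f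
annihilates-recurrenceOp {c} {f} rf k = begin
  + 1 ℤ.* f k ℤ.+ (ℤ.- c ℤ.* f k₁ ℤ.+ (+ 1 ℤ.* f (k₁ ℤ.+ + 1) ℤ.+ + 0))
    ≡⟨ rearrange (f k) c (f k₁) (f (k₁ ℤ.+ + 1)) ⟩
  (f (k₁ ℤ.+ + 1) ℤ.+ f k) ℤ.- c ℤ.* f k₁
    ≡⟨ cong (λ z → z ℤ.- c ℤ.* f k₁) (trans (cong₂ (λ a b → f a ℤ.+ f b) (ℤP.+-comm k₁ (+ 1)) (back k))
                                             (rf k₁)) ⟩
  c ℤ.* f k₁ ℤ.- c ℤ.* f k₁
    ≡⟨ ℤP.+-inverseʳ (c ℤ.* f k₁) ⟩
  + 0 ∎
  where
  k₁ = k ℤ.+ + 1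
  rearrange : ∀ a c b d → + 1 ℤ.* a ℤ.+ (ℤ.- c ℤ.* b ℤ.+ (+ 1 ℤ.* d ℤ.+ + 0)) ≡ (d ℤ.+ a) ℤ.- c ℤ.* b
  rearrange = solve-∀
  back : ∀ k → k ≡ -[1+ 0 ] ℤ.+ (k ℤ.+ + 1)
  back = solve-∀

quadraticProduct : (ℕ → ℤ) → ℕ → List ℤ
quadraticProduct g zero    = + 1 ∷ []
quadraticProduct g (suc i) = recurrenceOp (g i) *P quadraticProduct g i

annihilates-partial-sums : ∀ {g : ℕ → ℤ} {G F : ℕ → ℤ → ℤ} →
  (∀ l → Recurrentℤ (g l) (G l)) → (∀ k → F 0 k ≡ + 0) → (∀ l k → F (suc l) k ≡ G l k ℤ.+ F l k) →
  ∀ l → Annihilates (quadraticProduct g l) (F l)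
annihilates-partial-sums {F = F} rG F₀≡0 F-step zero k =
  trans (cong (λ z → + 1 ℤ.* z ℤ.+ + 0) (F₀≡0 k)) refl
annihilates-partial-sums {g} {G} {F} rG F₀≡0 F-step (suc l) k =
  trans (applyOpℤ-cong (quadraticProduct g (suc l)) (F-step l) k)
    (annihilates-+ {quadraticProduct g (suc l)} {G l} {F l}
      (annihilates-*P-left (recurrenceOp (g l)) (quadraticProduct g l)
        (annihilates-recurrenceOp {g l} {G l} (rG l)))
      (annihilates-*P-right (recurrenceOp (g l)) (quadraticProduct g l)
        (annihilates-partial-sums {g} {G} {F} rG F₀≡0 F-step l))
      k)

applyOp-map-ℤtoℚ : ∀ L f v k →
  applyOp (map ℤtoℚ L) (λ k → ℤtoℚ (f k) ℚ.* v) k ≡ ℤtoℚ (applyOpℤ L f k) ℚ.* v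
applyOp-map-ℤtoℚ []      f v k = sym (ℚP.*-zeroˡ v)
applyOp-map-ℤtoℚ (c ∷ L) f v k = begin
  ℤtoℚ c ℚ.* (ℤtoℚ (f k) ℚ.* v) ℚ.+ applyOp (map ℤtoℚ L) (λ k → ℤtoℚ (f k) ℚ.* v) (k ℤ.+ + 1)
    ≡⟨ cong₂ ℚ._+_ (sym (ℚP.*-assoc (ℤtoℚ c) _ v)) (applyOp-map-ℤtoℚ L f v (k ℤ.+ + 1)) ⟩
  ℤtoℚ c ℚ.* ℤtoℚ (f k) ℚ.* v ℚ.+ ℤtoℚ (applyOpℤ L f (k ℤ.+ + 1)) ℚ.* v
    ≡⟨ sym (ℚP.*-distribʳ-+ v (ℤtoℚ c ℚ.* ℤtoℚ (f k)) (ℤtoℚ (applyOpℤ L f (k ℤ.+ + 1)))) ⟩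
  (ℤtoℚ c ℚ.* ℤtoℚ (f k) ℚ.+ ℤtoℚ (applyOpℤ L f (k ℤ.+ + 1))) ℚ.* v
    ≡⟨ cong (ℚ._* v) (sym (trans (ℤtoℚ-+ (c ℤ.* f k) rest) (cong (ℚ._+ ℤtoℚ rest) (ℤtoℚ-* c (f k))))) ⟩
  ℤtoℚ (c ℤ.* f k ℤ.+ applyOpℤ L f (k ℤ.+ + 1)) ℚ.* v ∎
  where rest = applyOpℤ L f (k ℤ.+ + 1)

Monic : ℕ → List ℤ → Set
Monic n P = Σ (List ℤ) λ xs → (P ≡ xs ++ + 1 ∷ []) × (length xs ≡ n)

private
  +P-++ : ∀ P Q R → length P ≤ length Q → P +P (Q ++ R) ≡ (P +P Q) ++ R
  +P-++ []      Q       R _         = refl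
  +P-++ (p ∷ P) (q ∷ Q) R (ℕ.s≤s le) = cong (p ℤ.+ q ∷_) (+P-++ P Q R le)

  length-+P : ∀ P Q → length P ≤ length Q → length (P +P Q) ≡ length Q
  length-+P []      Q       _         = refl
  length-+P (p ∷ P) (q ∷ Q) (ℕ.s≤s le) = cong suc (length-+P P Q le)

  1*P : ∀ q Q → (+ 1 ∷ []) *P (q ∷ Q) ≡ q ∷ Q
  1*P q Q = cong₂ _∷_ (trans (ℤP.+-identityʳ _) (ℤP.*-identityˡ q)) (trans (+P-[] _) (map-1* Q))
    where
    +P-[] : ∀ P → P +P [] ≡ P
    +P-[] []      = refl
    +P-[] (p ∷ P) = refl
    map-1* : ∀ Q → map (+ 1 ℤ.*_) Q ≡ Q
    map-1* []      = refl
    map-1* (q ∷ Q) = cong₂ _∷_ (ℤP.*-identityˡ q) (map-1* Q)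

  monic-++-*P : ∀ xs ys → Monic (length xs ℕ.+ length ys) ((xs ++ + 1 ∷ []) *P (ys ++ + 1 ∷ []))
  monic-++-*P []       []       = [] , refl , refl
  monic-++-*P []       (y ∷ ys) = y ∷ ys , 1*P y (ys ++ + 1 ∷ []) , refl
  monic-++-*P (x ∷ xs) ys with monic-++-*P xs ys
  ... | zs , eq , len =
    xQ +P (+ 0 ∷ zs) ,
    trans (cong (λ P → xQ +P (+ 0 ∷ P)) eq) (+P-++ xQ (+ 0 ∷ zs) (+ 1 ∷ []) shorter) ,
    trans (length-+P xQ (+ 0 ∷ zs) shorter) (cong suc len)
    where
    xQ = map (x ℤ.*_) (ys ++ + 1 ∷ [])
    shorter : length xQ ≤ length (+ 0 ∷ zs)
    shorter = subst₂ _≤_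
      (sym (trans (LP.length-map (x ℤ.*_) (ys ++ + 1 ∷ []))
                  (trans (LP.length-++ ys) (ℕP.+-comm (length ys) 1))))
      (cong suc (sym len))
      (ℕ.s≤s (ℕP.m≤n+m (length ys) (length xs)))

monic-*P : ∀ {a b P Q} → Monic a P → Monic b Q → Monic (a ℕ.+ b) (P *P Q)
monic-*P (xs , refl , refl) (ys , refl , refl) = monic-++-*P xs ys

monic-quadraticProduct : ∀ g l → Monic (2 ℕ.* l) (quadraticProduct g l)
monic-quadraticProduct g zero    = [] , refl , refl
monic-quadraticProduct g (suc l) =
  subst (λ n → Monic n (quadraticProduct g (suc l))) (sym (ℕP.*-suc 2 l))
    (monic-*P (+ 1 ∷ ℤ.- g l ∷ [] , refl , refl) (monic-quadraticProduct g l))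

constantCoeff : List ℤ → ℤ
constantCoeff []      = + 0
constantCoeff (a ∷ _) = a

constantCoeff-*P : ∀ P Q → constantCoeff (P *P Q) ≡ constantCoeff P ℤ.* constantCoeff Q
constantCoeff-*P []      Q       = sym (ℤP.*-zeroˡ (constantCoeff Q))
constantCoeff-*P (a ∷ P) []      = sym (ℤP.*-zeroʳ a)
constantCoeff-*P (a ∷ P) (b ∷ Q) = ℤP.+-identityʳ (a ℤ.* b)

constantCoeff-quadraticProduct : ∀ g l → constantCoeff (quadraticProduct g l) ≡ + 1
constantCoeff-quadraticProduct g zero    = refl
constantCoeff-quadraticProduct g (suc l) =
  trans (constantCoeff-*P (recurrenceOp (g l)) (quadraticProduct g l))
    (trans (cong (+ 1 ℤ.*_) (constantCoeff-quadraticProduct g l)) refl)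

module QuadraticRing (m : ℤ) where
  open ZX m using (_⊕_; _⊗_; ⊖_)

  0x 1x : ℤx
  0x = (+ 0 , + 0)
  1x = (+ 1 , + 0)

  private
    open import Algebra.Definitions {A = ℤx} _≡_
    open import Algebra.Consequences.Propositional {A = ℤx}
      using (comm∧idˡ⇒id; comm∧invˡ⇒inv; comm∧distrˡ⇒distrʳ)

    ⊕-assoc : Associative _⊕_
    ⊕-assoc (a , b) (c , d) (e , f) = cong₂ _,_ (ℤP.+-assoc a c e) (ℤP.+-assoc b d f)

    ⊕-comm : Commutative _⊕_
    ⊕-comm (a , b) (c , d) = cong₂ _,_ (ℤP.+-comm a c) (ℤP.+-comm b d)

    ⊕-identityˡ : LeftIdentity 0x _⊕_
    ⊕-identityˡ (a , b) = cong₂ _,_ (ℤP.+-identityˡ a) (ℤP.+-identityˡ b)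

    ⊖-inverseˡ : LeftInverse 0x ⊖_ _⊕_
    ⊖-inverseˡ (a , b) = cong₂ _,_ (ℤP.+-inverseˡ a) (ℤP.+-inverseˡ b)

    ⊗-assoc : Associative _⊗_
    ⊗-assoc (a , b) (c , d) (e , f) = cong₂ _,_ (re m a b c d e f) (im m a b c d e f)
      where
      re : ∀ m a b c d e f →
        (a ℤ.* c ℤ.+ m ℤ.* (b ℤ.* d)) ℤ.* e ℤ.+ m ℤ.* ((a ℤ.* d ℤ.+ b ℤ.* c) ℤ.* f)
        ≡ a ℤ.* (c ℤ.* e ℤ.+ m ℤ.* (d ℤ.* f)) ℤ.+ m ℤ.* (b ℤ.* (c ℤ.* f ℤ.+ d ℤ.* e))
      re = solve-∀
      im : ∀ m a b c d e f →
        (a ℤ.* c ℤ.+ m ℤ.* (b ℤ.* d)) ℤ.* f ℤ.+ (a ℤ.* d ℤ.+ b ℤ.* c) ℤ.* e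
        ≡ a ℤ.* (c ℤ.* f ℤ.+ d ℤ.* e) ℤ.+ b ℤ.* (c ℤ.* e ℤ.+ m ℤ.* (d ℤ.* f))
      im = solve-∀

    ⊗-comm : Commutative _⊗_
    ⊗-comm (a , b) (c , d) = cong₂ _,_ (re m a b c d) (im a b c d)
      where
      re : ∀ m a b c d → a ℤ.* c ℤ.+ m ℤ.* (b ℤ.* d) ≡ c ℤ.* a ℤ.+ m ℤ.* (d ℤ.* b)
      re = solve-∀
      im : ∀ a b c d → a ℤ.* d ℤ.+ b ℤ.* c ≡ c ℤ.* b ℤ.+ d ℤ.* a
      im = solve-∀

    ⊗-identityˡ : LeftIdentity 1x _⊗_
    ⊗-identityˡ (a , b) = cong₂ _,_ (re m a b) (im a b)
      where
      re : ∀ m a b → + 1 ℤ.* a ℤ.+ m ℤ.* (+ 0 ℤ.* b) ≡ a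
      re = solve-∀
      im : ∀ a b → + 1 ℤ.* b ℤ.+ + 0 ℤ.* a ≡ b
      im = solve-∀

    ⊗-distribˡ : _⊗_ DistributesOverˡ _⊕_
    ⊗-distribˡ (a , b) (c , d) (e , f) = cong₂ _,_ (re m a b c d e f) (im a b c d e f)
      where
      re : ∀ m a b c d e f →
        a ℤ.* (c ℤ.+ e) ℤ.+ m ℤ.* (b ℤ.* (d ℤ.+ f))
        ≡ (a ℤ.* c ℤ.+ m ℤ.* (b ℤ.* d)) ℤ.+ (a ℤ.* e ℤ.+ m ℤ.* (b ℤ.* f))
      re = solve-∀
      im : ∀ a b c d e f →
        a ℤ.* (d ℤ.+ f) ℤ.+ b ℤ.* (c ℤ.+ e)
        ≡ (a ℤ.* d ℤ.+ b ℤ.* c) ℤ.+ (a ℤ.* f ℤ.+ b ℤ.* e)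
      im = solve-∀

  isCommutativeRing : IsCommutativeRing _≡_ _⊕_ _⊗_ ⊖_ 0x 1x
  isCommutativeRing = record
    { isRing = record
      { +-isAbelianGroup = record
        { isGroup = record
          { isMonoid = record
            { isSemigroup = record
              { isMagma = record { isEquivalence = isEquivalence ; ∙-cong = cong₂ _⊕_ }
              ; assoc = ⊕-assoc
              }
            ; identity = comm∧idˡ⇒id ⊕-comm ⊕-identityˡ
            }
          ; inverse = comm∧invˡ⇒inv ⊕-comm ⊖-inverseˡ
          ; ⁻¹-cong = cong ⊖_
          }
        ; comm = ⊕-comm
        }
      ; *-cong = cong₂ _⊗_
      ; *-assoc = ⊗-assoc
      ; *-identity = comm∧idˡ⇒id ⊗-comm ⊗-identityˡ
      ; distrib = ⊗-distribˡ , comm∧distrˡ⇒distrʳ ⊗-comm ⊗-distribˡ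
      }
    ; *-comm = ⊗-comm
    }

  open Chebyshev isCommutativeRing public
  open CommutativeRing commutativeRing public using (_+_; _*_; -_; _-_)

  scalar : ℤ → ℤx
  scalar a = (a , + 0)

  scalar-biseq : ∀ c u₀ u₁ k → scalar (biseqℤ c u₀ u₁ k) ≡ biseq (scalar c) (scalar u₀) (scalar u₁) k
  scalar-biseq = biseq-map scalar λ c u₀ u₁ → cong₂ _,_ (re m c u₀ u₁) (im c u₁)
    where
    re : ∀ m c u₀ u₁ → c ℤ.* u₁ ℤ.- u₀ ≡ (c ℤ.* u₁ ℤ.+ m ℤ.* (+ 0 ℤ.* + 0)) ℤ.- u₀
    re = solve-∀
    im : ∀ c u₁ → + 0 ≡ (c ℤ.* + 0 ℤ.+ + 0 ℤ.* u₁) ℤ.- + 0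
    im = solve-∀

  scalar-* : ∀ a b → scalar (a ℤ.* b) ≡ scalar a * scalar b
  scalar-* a b = cong₂ _,_ (re m a b) (im a b)
    where
    re : ∀ m a b → a ℤ.* b ≡ a ℤ.* b ℤ.+ m ℤ.* (+ 0 ℤ.* + 0)
    re = solve-∀
    im : ∀ a b → + 0 ≡ a ℤ.* + 0 ℤ.+ + 0 ℤ.* b
    im = solve-∀

  proj₁-scalar-* : ∀ c w → proj₁ (scalar c * w) ≡ c ℤ.* proj₁ w
  proj₁-scalar-* c (a , b) = re m c a b
    where
    re : ∀ m c a b → c ℤ.* a ℤ.+ m ℤ.* (+ 0 ℤ.* b) ≡ c ℤ.* a
    re = solve-∀

  proj₂-scalar-* : ∀ c w → proj₂ (scalar c * w) ≡ c ℤ.* proj₂ w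
  proj₂-scalar-* c (a , b) = im c a b
    where
    im : ∀ c a b → c ℤ.* b ℤ.+ + 0 ℤ.* a ≡ c ℤ.* b
    im = solve-∀

  recurrent-components : ∀ {c F} → Recurrent (scalar c) F →
    Recurrentℤ c (λ k → proj₁ (F k)) × Recurrentℤ c (λ k → proj₂ (F k))
  recurrent-components {c} {F} rF =
    (λ k → trans (cong proj₁ (rF k)) (proj₁-scalar-* c (F k))) ,
    (λ k → trans (cong proj₂ (rF k)) (proj₂-scalar-* c (F k)))

  T-scalar : ∀ q c → scalar (𝒯 q c) ≡ T q (scalar c)
  T-scalar q c = scalar-biseq c (+ 2) c q

  U-scalar : ∀ q c → scalar (𝒰 q c) ≡ U q (scalar c)
  U-scalar q c = scalar-biseq c (+ 1) c q

  module _ {c y} (T₂y≡c : T (+ 2) y ≡ scalar c) where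

    s-as-U : ∀ k → scalar (s k c) ≡ U (+ 2 ℤ.* k) y
    s-as-U k = begin
      scalar (s k c)                                ≡⟨ scalar-biseq c (+ 1) (c ℤ.+ + 1) k ⟩
      biseq (scalar c) 1x (scalar c + 1x) k         ≡⟨ cong (λ z → biseq z 1x (z + 1x) k) (sym T₂y≡c) ⟩
      biseq (T (+ 2) y) 1x (T (+ 2) y + 1x) k       ≡⟨ U-even k y ⟩
      U (+ 2 ℤ.* k) y                               ∎

    r-as-T : ∀ k → scalar (r k c) * y ≡ T (+ 2 ℤ.* k ℤ.+ + 1) y
    r-as-T k = begin
      scalar (r k c) * y                                ≡⟨ cong (_* y) (scalar-biseq c (+ 1) (c ℤ.- + 1) k) ⟩
      biseq (scalar c) 1x (scalar c - 1x) k * y       ≡⟨ cong (λ z → biseq z 1x (z - 1x) k * y) (sym T₂y≡c) ⟩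
      biseq (T (+ 2) y) 1x (T (+ 2) y - 1x) k * y     ≡⟨ T-odd k y ⟩
      T (+ 2 ℤ.* k ℤ.+ + 1) y                           ∎

  U-odd-as-𝒰 : ∀ {c y} → T (+ 2) y ≡ scalar c → ∀ n → U (+ suc (2 ℕ.* n)) y ≡ scalar (𝒰 (+ n) c) * y
  U-odd-as-𝒰 {c} {y} T₂y≡c n = begin
    U (+ suc (2 ℕ.* n)) y           ≡⟨ cong (λ i → U (+ suc i) y) (ℕP.*-comm 2 n) ⟩
    U (+ suc n ℤ.* + 2 ℤ.- + 1) y   ≡⟨ sym (U-∘ (+ suc n) (+ 2) y) ⟩
    U (+ n) (T (+ 2) y) * y         ≡⟨ cong (λ z → U (+ n) z * y) T₂y≡c ⟩
    U (+ n) (scalar c) * y          ≡⟨ cong (_* y) (sym (U-scalar (+ n) c)) ⟩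
    scalar (𝒰 (+ n) c) * y          ∎

  MulEqℂ-scalar : ∀ ε q a b w → q ℚ.* ℤtoℚ a ≡ ℤtoℚ b → MulEqℂ ε m q (scalar a * w) (scalar b * w)
  MulEqℂ-scalar ε q a b w qa≡b =
    subst₂ (IsZeroℂ ε m)
      (sym (trans (difference (proj₁-scalar-* a w) (proj₁-scalar-* b w)) (vanish (proj₁ w))))
      (sym (trans (difference (proj₂-scalar-* a w) (proj₂-scalar-* b w)) (vanish (proj₂ w))))
      (IsZeroℂ-0 ε m)
    where
    difference : ∀ {u u′ v v′} → u ≡ u′ → v ≡ v′ → q ℚ.* ℤtoℚ u ℚ.- ℤtoℚ v ≡ q ℚ.* ℤtoℚ u′ ℚ.- ℤtoℚ v′
    difference = cong₂ (λ u v → q ℚ.* ℤtoℚ u ℚ.- ℤtoℚ v)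

    vanish : ∀ u → q ℚ.* ℤtoℚ (a ℤ.* u) ℚ.- ℤtoℚ (b ℤ.* u) ≡ ℚ.0ℚ
    vanish u = begin
      q ℚ.* ℤtoℚ (a ℤ.* u) ℚ.- ℤtoℚ (b ℤ.* u)
        ≡⟨ cong₂ (λ s t → q ℚ.* s ℚ.- t) (ℤtoℚ-* a u) (ℤtoℚ-* b u) ⟩
      q ℚ.* (ℤtoℚ a ℚ.* ℤtoℚ u) ℚ.- ℤtoℚ b ℚ.* ℤtoℚ u
        ≡⟨ cong (ℚ._- ℤtoℚ b ℚ.* ℤtoℚ u)
             (trans (sym (ℚP.*-assoc q (ℤtoℚ a) (ℤtoℚ u))) (cong (ℚ._* ℤtoℚ u) qa≡b)) ⟩
      ℤtoℚ b ℚ.* ℤtoℚ u ℚ.- ℤtoℚ b ℚ.* ℤtoℚ u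
        ≡⟨ ℚP.+-inverseʳ (ℤtoℚ b ℚ.* ℤtoℚ u) ⟩
      ℚ.0ℚ ∎

module SquareRoot (j : ℤ) where
  open QuadraticRing (j ℤ.+ + 2) public
  open CommutativeRing commutativeRing using (*-assoc; *-identityʳ; zeroˡ; *-commutativeSemigroup)
  open import Algebra.Properties.CommutativeSemigroup *-commutativeSemigroup using (xy∙z≈xz∙y)

  x : ℤx
  x = ZX.xgen (j ℤ.+ + 2)

  T₂x≡j : T (+ 2) x ≡ scalar j
  T₂x≡j = cong₂ _,_ (re j) refl
    where
    re : ∀ j → (+ 0 ℤ.* + 0 ℤ.+ (j ℤ.+ + 2) ℤ.* (+ 1 ℤ.* + 1)) ℤ.- (+ 1 ℤ.+ + 1) ≡ j
    re = solve-∀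

  Y : ℤ → ℤx
  Y k = T (+ 2 ℤ.* k ℤ.+ + 1) x

  T₂∘T≡𝒯 : ∀ q → T (+ 2) (T q x) ≡ scalar (𝒯 q j)
  T₂∘T≡𝒯 q = trans (T-∘-comm (+ 2) q x) (trans (cong (T q) T₂x≡j) (sym (T-scalar q j)))

  T∘Y-recurrent : ∀ q → Recurrent (scalar (𝒯 q j)) (λ k → T q (Y k))
  T∘Y-recurrent q = subst (λ c → Recurrent c (λ k → T q (Y k)))
    (trans (cong (T q) T₂x≡j) (sym (T-scalar q j))) (T-∘-recurrent q (+ 2) (+ 1) x)

  T∘Y-components : ∀ q →
    Recurrentℤ (𝒯 q j) (λ k → proj₁ (T q (Y k))) × Recurrentℤ (𝒯 q j) (λ k → proj₂ (T q (Y k)))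
  T∘Y-components q = recurrent-components {𝒯 q j} {λ k → T q (Y k)} (T∘Y-recurrent q)

  s-𝒯-ratio : ∀ p′ k →
    scalar (s k (𝒯 (+ suc p′) j)) * U (+ p′) x ≡ U (+ p′) (Y k) * scalar (s k j)
  s-𝒯-ratio p′ k = begin
    scalar (s k (𝒯 p j)) * U (+ p′) x            ≡⟨ cong (_* U (+ p′) x) (s-as-U (T₂∘T≡𝒯 p) k) ⟩
    U (+ 2 ℤ.* k) (T p x) * U (+ p′) x           ≡⟨ cong (λ i → U i (T p x) * U (+ p′) x) (sym (odd-1 k)) ⟩
    U (a ℤ.- + 1) (T p x) * U (p ℤ.- + 1) x      ≡⟨ U-∘-swap a p x ⟩
    U (p ℤ.- + 1) (T a x) * U (a ℤ.- + 1) x      ≡⟨ cong (λ i → U (+ p′) (Y k) * U i x) (odd-1 k) ⟩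
    U (+ p′) (Y k) * U (+ 2 ℤ.* k) x             ≡⟨ cong (U (+ p′) (Y k) *_) (sym (s-as-U T₂x≡j k)) ⟩
    U (+ p′) (Y k) * scalar (s k j)              ∎
    where
    p = + suc p′
    a = + 2 ℤ.* k ℤ.+ + 1
    odd-1 : ∀ k → (+ 2 ℤ.* k ℤ.+ + 1) ℤ.- + 1 ≡ + 2 ℤ.* k
    odd-1 = solve-∀

  record IntegerRatio (p′ : ℕ) : Set where
    field
      unit        : ℤx
      unit-cancel : ∀ {a b} → scalar a * unit ≡ scalar b * unit → a ≡ b
      den         : ℤ
      num         : ℤ → ℤ
      den-form    : U (+ p′) x ≡ scalar den * unit
      num-form    : ∀ k → U (+ p′) (Y k) ≡ scalar (num k) * unit

  module RatioSequence {p′} (ρ : IntegerRatio p′) (ε : Sign)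
    (nz : ¬ IsZeroℤx ε (j ℤ.+ + 2) (U (+ p′) x)) where
    open IntegerRatio ρ

    den≢0 : den ≢ + 0
    den≢0 refl = nz (subst (IsZeroℤx ε (j ℤ.+ + 2)) (sym (trans den-form (zeroˡ unit))) (IsZeroℂ-0 ε _))

    instance
      den-nonZero : ℚ.NonZero (ℤtoℚ den)
      den-nonZero = ℚ.≢-nonZero (λ eq → den≢0 (ℤtoℚ-injective eq))

    R : ℤ → ℚ
    R k = ℤtoℚ (num k) ℚ.* ℚ.1/ ℤtoℚ den

    R*den≡num : ∀ k → R k ℚ.* ℤtoℚ den ≡ ℤtoℚ (num k)
    R*den≡num k = begin
      ℤtoℚ (num k) ℚ.* ℚ.1/ ℤtoℚ den ℚ.* ℤtoℚ den   ≡⟨ ℚP.*-assoc (ℤtoℚ (num k)) _ _ ⟩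
      ℤtoℚ (num k) ℚ.* (ℚ.1/ ℤtoℚ den ℚ.* ℤtoℚ den) ≡⟨ cong (ℤtoℚ (num k) ℚ.*_) (ℚP.*-inverseˡ (ℤtoℚ den)) ⟩
      ℤtoℚ (num k) ℚ.* ℚ.1ℚ                         ≡⟨ ℚP.*-identityʳ (ℤtoℚ (num k)) ⟩
      ℤtoℚ (num k)                                  ∎

    R-mulEq : ∀ k → MulEqℂ ε (j ℤ.+ + 2) (R k) (U (+ p′) x) (U (+ p′) (Y k))
    R-mulEq k = subst₂ (MulEqℂ ε (j ℤ.+ + 2) (R k)) (sym den-form) (sym (num-form k))
      (MulEqℂ-scalar ε (R k) den (num k) unit (R*den≡num k))

    R-s-ratio : ∀ k → ℤtoℚ (s k (𝒯 (+ suc p′) j)) ≡ R k ℚ.* ℤtoℚ (s k j)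
    R-s-ratio k = begin
      ℤtoℚ a                                              ≡⟨ sym (ℚP.*-identityʳ (ℤtoℚ a)) ⟩
      ℤtoℚ a ℚ.* ℚ.1ℚ                                     ≡⟨ cong (ℤtoℚ a ℚ.*_) (sym (ℚP.*-inverseʳ (ℤtoℚ den))) ⟩
      ℤtoℚ a ℚ.* (ℤtoℚ den ℚ.* ℚ.1/ ℤtoℚ den)             ≡⟨ sym (ℚP.*-assoc (ℤtoℚ a) _ _) ⟩
      ℤtoℚ a ℚ.* ℤtoℚ den ℚ.* ℚ.1/ ℤtoℚ den               ≡⟨ cong (ℚ._* ℚ.1/ ℤtoℚ den) (sym (ℤtoℚ-* a den)) ⟩
      ℤtoℚ (a ℤ.* den) ℚ.* ℚ.1/ ℤtoℚ den                  ≡⟨ cong (λ z → ℤtoℚ z ℚ.* ℚ.1/ ℤtoℚ den) cross-multiplied ⟩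
      ℤtoℚ (num k ℤ.* s k j) ℚ.* ℚ.1/ ℤtoℚ den            ≡⟨ cong (ℚ._* ℚ.1/ ℤtoℚ den) (ℤtoℚ-* (num k) (s k j)) ⟩
      ℤtoℚ (num k) ℚ.* ℤtoℚ (s k j) ℚ.* ℚ.1/ ℤtoℚ den     ≡⟨ ℚ-xy∙z≈xz∙y (ℤtoℚ (num k)) _ _ ⟩
      R k ℚ.* ℤtoℚ (s k j)                                ∎
      where
      open import Algebra.Properties.CommutativeSemigroup
        (CommutativeRing.*-commutativeSemigroup ℚP.+-*-commutativeRing)
        using () renaming (xy∙z≈xz∙y to ℚ-xy∙z≈xz∙y)
      a = s k (𝒯 (+ suc p′) j)
      cross-multiplied : a ℤ.* den ≡ num k ℤ.* s k j
      cross-multiplied = unit-cancel (begin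
        scalar (a ℤ.* den) * unit             ≡⟨ cong (_* unit) (scalar-* a den) ⟩
        scalar a * scalar den * unit          ≡⟨ *-assoc (scalar a) (scalar den) unit ⟩
        scalar a * (scalar den * unit)        ≡⟨ cong (scalar a *_) (sym den-form) ⟩
        scalar a * U (+ p′) x                 ≡⟨ s-𝒯-ratio p′ k ⟩
        U (+ p′) (Y k) * scalar (s k j)       ≡⟨ cong (_* scalar (s k j)) (num-form k) ⟩
        scalar (num k) * unit * scalar (s k j) ≡⟨ xy∙z≈xz∙y (scalar (num k)) unit (scalar (s k j)) ⟩
        scalar (num k) * scalar (s k j) * unit ≡⟨ cong (_* unit) (sym (scalar-* (num k) (s k j))) ⟩
        scalar (num k ℤ.* s k j) * unit       ∎)

    R-annihilated : ∀ L → Annihilates L num → ∀ k → applyOp (map ℤtoℚ L) R k ≡ ℚ.0ℚ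
    R-annihilated L ann k = begin
      applyOp (map ℤtoℚ L) R k                     ≡⟨ applyOp-map-ℤtoℚ L num (ℚ.1/ ℤtoℚ den) k ⟩
      ℤtoℚ (applyOpℤ L num k) ℚ.* ℚ.1/ ℤtoℚ den    ≡⟨ cong (λ z → ℤtoℚ z ℚ.* ℚ.1/ ℤtoℚ den) (ann k) ⟩
      ℚ.0ℚ ℚ.* ℚ.1/ ℤtoℚ den                       ≡⟨ ℚP.*-zeroˡ (ℚ.1/ ℤtoℚ den) ⟩
      ℚ.0ℚ                                         ∎

    R-recurrence : ∀ L → Monic (suc p′) L → constantCoeff L ≢ + 0 → Annihilates L num →
      Σ ℚ λ c₀ → Σ (List ℚ) λ cs → (length cs ≡ p′) × (c₀ ≢ ℚ.0ℚ)
        × (∀ k → applyOp (c₀ ∷ cs ++ ℚ.1ℚ ∷ []) R k ≡ ℚ.0ℚ)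
    R-recurrence _ (c ∷ cs , refl , len) c≢0 ann =
      ℤtoℚ c , map ℤtoℚ cs , trans (LP.length-map ℤtoℚ cs) (ℕP.suc-injective len) ,
      (λ eq → c≢0 (ℤtoℚ-injective eq)) ,
      λ k → trans (cong (λ L → applyOp (ℤtoℚ c ∷ L) R k) (sym (LP.map-++ ℤtoℚ cs (+ 1 ∷ []))))
                  (R-annihilated (c ∷ cs ++ + 1 ∷ []) ann k)

  s-as-U-even : ∀ {c y} → T (+ 2) y ≡ scalar c → ∀ n → scalar (s (+ n) c) ≡ U (+ (2 ℕ.* n)) y
  s-as-U-even {y = y} T₂y≡c n = trans (s-as-U T₂y≡c (+ n)) (cong (λ i → U i y) (sym (ℤP.pos-* 2 n)))

  oddRatio : ∀ n → IntegerRatio (2 ℕ.* n)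
  oddRatio n = record
    { unit        = 1x
    ; unit-cancel = λ {a} {b} eq →
        cong proj₁ (trans (sym (*-identityʳ (scalar a))) (trans eq (*-identityʳ (scalar b))))
    ; den         = s (+ n) j
    ; num         = λ k → s (+ n) (𝒯 (+ 2 ℤ.* k ℤ.+ + 1) j)
    ; den-form    = trans (sym (s-as-U-even T₂x≡j n)) (sym (*-identityʳ _))
    ; num-form    = λ k → trans (sym (s-as-U-even (T₂∘T≡𝒯 (+ 2 ℤ.* k ℤ.+ + 1)) n)) (sym (*-identityʳ _))
    }

  prodFactors≡quadraticProduct : ∀ n → prodFactors n j ≡ quadraticProduct (λ i → 𝒯 (+ (2 ℕ.* suc i)) j) n
  prodFactors≡quadraticProduct zero    = refl
  prodFactors≡quadraticProduct (suc n) =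
    cong (recurrenceOp (𝒯 (+ (2 ℕ.* suc n)) j) *P_) (prodFactors≡quadraticProduct n)

  monic-annihilator : ∀ n → Monic (suc (2 ℕ.* n)) (annihilator n j)
  monic-annihilator n = monic-*P (ℤ.- + 1 ∷ [] , refl , refl)
    (subst (Monic (2 ℕ.* n)) (sym (prodFactors≡quadraticProduct n)) (monic-quadraticProduct _ n))

  constantCoeff-annihilator≢0 : ∀ n → constantCoeff (annihilator n j) ≢ + 0
  constantCoeff-annihilator≢0 n eq with trans (sym constantCoeff≡-1) eq
    where
    constantCoeff≡-1 : constantCoeff (annihilator n j) ≡ -[1+ 0 ]
    constantCoeff≡-1 = trans (constantCoeff-*P (ℤ.- + 1 ∷ + 1 ∷ []) (prodFactors n j))
      (cong (ℤ.- + 1 ℤ.*_) (trans (cong constantCoeff (prodFactors≡quadraticProduct n))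
                                   (constantCoeff-quadraticProduct _ n)))
  ... | ()

  annihilates-annihilator : ∀ n → Annihilates (annihilator n j) (IntegerRatio.num (oddRatio n))
  annihilates-annihilator n k =
    trans (applyOpℤ-cong (annihilator n j) num≡1+E k)
      (annihilates-+ {annihilator n j} {λ _ → + 1} {E n}
        (annihilates-*P-left (ℤ.- + 1 ∷ + 1 ∷ []) (prodFactors n j) (λ _ → refl))
        (annihilates-*P-right (ℤ.- + 1 ∷ + 1 ∷ []) (prodFactors n j)
          (subst (λ P → Annihilates P (E n)) (sym (prodFactors≡quadraticProduct n))
            (annihilates-partial-sums {G = λ l k → proj₁ (T (+ (2 ℕ.* suc l)) (Y k))} {F = E}
              (λ l → proj₁ (T∘Y-components (+ (2 ℕ.* suc l))))
              (λ _ → refl) E-step n)))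
        k)
    where
    E : ℕ → ℤ → ℤ
    E l k = proj₁ (U (+ (2 ℕ.* l)) (Y k)) ℤ.- + 1

    E-step : ∀ l k → E (suc l) k ≡ proj₁ (T (+ (2 ℕ.* suc l)) (Y k)) ℤ.+ E l k
    E-step l k = begin
      proj₁ (U i (Y k)) ℤ.- + 1
        ≡⟨ cong (λ z → proj₁ z ℤ.- + 1) (U-split i (Y k)) ⟩
      proj₁ (T i (Y k)) ℤ.+ proj₁ (U (i ℤ.- + 2) (Y k)) ℤ.- + 1
        ≡⟨ ℤP.+-assoc (proj₁ (T i (Y k))) _ _ ⟩
      proj₁ (T i (Y k)) ℤ.+ (proj₁ (U (i ℤ.- + 2) (Y k)) ℤ.- + 1)
        ≡⟨ cong (λ z → proj₁ (T i (Y k)) ℤ.+ (proj₁ (U (+ z ℤ.- + 2) (Y k)) ℤ.- + 1)) (ℕP.*-suc 2 l) ⟩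
      proj₁ (T i (Y k)) ℤ.+ E l k ∎
      where i = + (2 ℕ.* suc l)

    num≡1+E : ∀ k → s (+ n) (𝒯 (+ 2 ℤ.* k ℤ.+ + 1) j) ≡ + 1 ℤ.+ E n k
    num≡1+E k = trans (cong proj₁ (s-as-U-even (T₂∘T≡𝒯 (+ 2 ℤ.* k ℤ.+ + 1)) n)) (1+[a-1] _)
      where
      1+[a-1] : ∀ a → a ≡ + 1 ℤ.+ (a ℤ.- + 1)
      1+[a-1] = solve-∀

  proj₂-scalar*x : ∀ a → proj₂ (scalar a * x) ≡ a
  proj₂-scalar*x a = trans (proj₂-scalar-* a x) (ℤP.*-identityʳ a)

  evenRatio : ∀ n → IntegerRatio (suc (2 ℕ.* n))
  evenRatio n = record
    { unit        = x
    ; unit-cancel = λ {a} {b} eq → trans (sym (proj₂-scalar*x a)) (trans (cong proj₂ eq) (proj₂-scalar*x b))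
    ; den         = 𝒰 (+ n) j
    ; num         = λ k → 𝒰 (+ n) (𝒯 (+ 2 ℤ.* k ℤ.+ + 1) j) ℤ.* r k j
    ; den-form    = U-odd-as-𝒰 T₂x≡j n
    ; num-form    = num-form
    }
    where
    num-form : ∀ k → U (+ suc (2 ℕ.* n)) (Y k) ≡ scalar (𝒰 (+ n) (𝒯 (+ 2 ℤ.* k ℤ.+ + 1) j) ℤ.* r k j) * x
    num-form k = begin
      U (+ suc (2 ℕ.* n)) (Y k)                 ≡⟨ U-odd-as-𝒰 (T₂∘T≡𝒯 (+ 2 ℤ.* k ℤ.+ + 1)) n ⟩
      scalar u * Y k                            ≡⟨ cong (scalar u *_) (sym (r-as-T T₂x≡j k)) ⟩
      scalar u * (scalar (r k j) * x)           ≡⟨ sym (*-assoc (scalar u) (scalar (r k j)) x) ⟩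
      scalar u * scalar (r k j) * x             ≡⟨ cong (_* x) (sym (scalar-* u (r k j))) ⟩
      scalar (u ℤ.* r k j) * x                  ∎
      where u = 𝒰 (+ n) (𝒯 (+ 2 ℤ.* k ℤ.+ + 1) j)

  oddProduct : ℕ → List ℤ
  oddProduct n = quadraticProduct (λ i → 𝒯 (+ suc (2 ℕ.* i)) j) (suc n)

  monic-oddProduct : ∀ n → Monic (suc (suc (2 ℕ.* n))) (oddProduct n)
  monic-oddProduct n = subst (λ d → Monic d (oddProduct n)) (ℕP.*-suc 2 n) (monic-quadraticProduct _ (suc n))

  constantCoeff-oddProduct≢0 : ∀ n → constantCoeff (oddProduct n) ≢ + 0
  constantCoeff-oddProduct≢0 n eq with trans (sym (constantCoeff-quadraticProduct _ (suc n))) eq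
  ... | ()

  annihilates-oddProduct : ∀ n → Annihilates (oddProduct n) (IntegerRatio.num (evenRatio n))
  annihilates-oddProduct n k =
    trans (applyOpℤ-cong (oddProduct n) num≡F k)
      (annihilates-partial-sums {G = λ l k → proj₂ (T (+ suc (2 ℕ.* l)) (Y k))} {F = F}
        (λ l → proj₂ (T∘Y-components (+ suc (2 ℕ.* l))))
        (λ k → cong proj₂ (U₋₁≡0 (Y k))) F-step (suc n) k)
    where
    F : ℕ → ℤ → ℤ
    F l k = proj₂ (U (+ (2 ℕ.* l) ℤ.- + 1) (Y k))

    U-odd-index : ∀ l k → U (+ (2 ℕ.* suc l) ℤ.- + 1) (Y k) ≡ U (+ suc (2 ℕ.* l)) (Y k)
    U-odd-index l k = cong (λ i → U (+ i ℤ.- + 1) (Y k)) (ℕP.*-suc 2 l)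

    F-step : ∀ l k → F (suc l) k ≡ proj₂ (T (+ suc (2 ℕ.* l)) (Y k)) ℤ.+ F l k
    F-step l k = cong proj₂ (begin
      U (+ (2 ℕ.* suc l) ℤ.- + 1) (Y k)                              ≡⟨ U-odd-index l k ⟩
      U (+ suc (2 ℕ.* l)) (Y k)                                       ≡⟨ U-split (+ suc (2 ℕ.* l)) (Y k) ⟩
      T (+ suc (2 ℕ.* l)) (Y k) + U (+ suc (2 ℕ.* l) ℤ.- + 2) (Y k)   ≡⟨ cong (λ i → T (+ suc (2 ℕ.* l)) (Y k) + U i (Y k))
                                                                             (lower-index (+ (2 ℕ.* l))) ⟩
      T (+ suc (2 ℕ.* l)) (Y k) + U (+ (2 ℕ.* l) ℤ.- + 1) (Y k)       ∎)
      where
      lower-index : ∀ a → (+ 1 ℤ.+ a) ℤ.- + 2 ≡ a ℤ.- + 1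
      lower-index = solve-∀

    num≡F : ∀ k → IntegerRatio.num (evenRatio n) k ≡ F (suc n) k
    num≡F k = begin
      num k                                      ≡⟨ sym (proj₂-scalar*x (num k)) ⟩
      proj₂ (scalar (num k) * x)                 ≡⟨ cong proj₂ (sym (num-form k)) ⟩
      proj₂ (U (+ suc (2 ℕ.* n)) (Y k))          ≡⟨ cong proj₂ (sym (U-odd-index n k)) ⟩
      F (suc n) k                                ∎
      where open IntegerRatio (evenRatio n)

  module _ (ε : Sign) (nz : ¬ IsZeroℤx ε (j ℤ.+ + 2) (U (+ 1) x)) where
    open RatioSequence (evenRatio 0) ε nz

    R≡r : ∀ k → R k ≡ ℤtoℚ (r k j)
    R≡r k = begin
      R k                         ≡⟨ sym (ℚP.*-identityʳ (R k)) ⟩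
      R k ℚ.* ℚ.1ℚ                ≡⟨ R*den≡num k ⟩
      ℤtoℚ (+ 1 ℤ.* r k j)        ≡⟨ cong ℤtoℚ (ℤP.*-identityˡ (r k j)) ⟩
      ℤtoℚ (r k j)                ∎

data OddOrEven : ℕ → Set where
  odd  : ∀ n → OddOrEven (suc (2 ℕ.* n))
  even : ∀ n → OddOrEven (suc (suc (2 ℕ.* n)))

oddOrEven : ∀ n → OddOrEven (suc n)
oddOrEven zero = odd 0
oddOrEven (suc n) with oddOrEven n
... | odd k  = even k
... | even k = subst OddOrEven (cong suc (ℕP.*-suc 2 k)) (odd (suc k))

theorem37 :
  (p : ℕ) → 2 ≤ p → (j : ℤ) → (ε : Sign) →
  let m2 = j ℤ.+ + 2
      x = ZX.xgen m2
      den = ZX.𝒰x m2 (+ (p ℕ.∸ 1)) x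
  in ¬ IsZeroℤx ε m2 den →
  Σ (ℤ → ℚ) λ R →
    (∀ k → MulEqℂ ε m2 (R k) den
             (ZX.𝒰x m2 (+ (p ℕ.∸ 1))
               (ZX.𝒯x m2 ((+ 2 ℤ.* k) ℤ.+ + 1) x)))
    × (∀ k → ℤtoℚ (s k (𝒯 (+ p) j)) ≡ R k ℚ.* ℤtoℚ (s k j))
    × (Σ ℚ λ c₀ → Σ (List ℚ) λ cs →
         (length cs ≡ p ℕ.∸ 1) × (c₀ ≢ ℚ.0ℚ)
         × (∀ k → applyOp (c₀ ∷ cs ++ ℚ.1ℚ ∷ []) R k ≡ ℚ.0ℚ))
    × (p ≡ 2 → ∀ k → R k ≡ ℤtoℚ (r k j))
    × ((m : ℕ) → p ≡ 1 ℕ.+ 2 ℕ.* m →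
         ((s (+ m) j ≢ + 0 →
            ∀ k → R k ℚ.* ℤtoℚ (s (+ m) j)
                    ≡ ℤtoℚ (s (+ m) (𝒯 ((+ 2 ℤ.* k) ℤ.+ + 1) j)))
          × (∀ k → applyOp (map ℤtoℚ (annihilator m j)) R k ≡ ℚ.0ℚ)))
theorem37 zero () j
-- The hypothesis 2 ≤ p only excludes p = 0; the argument also covers p = 1.
theorem37 (suc p′) _ j ε nz with oddOrEven p′
... | odd n =
  R , R-mulEq , R-s-ratio ,
  R-recurrence (annihilator n j) (monic-annihilator n) (constantCoeff-annihilator≢0 n) (annihilates-annihilator n) ,
  (λ p≡2 → ⊥-elim (ℕP.even≢odd n 0 (ℕP.suc-injective p≡2))) ,
  λ m p≡1+2m → case ℕP.*-cancelˡ-≡ n m 2 (ℕP.suc-injective p≡1+2m) of λ where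
    refl → (λ _ → R*den≡num) , R-annihilated (annihilator n j) (annihilates-annihilator n)
  where
  open SquareRoot j
  open RatioSequence (oddRatio n) ε nz
... | even n =
  R , R-mulEq , R-s-ratio ,
  R-recurrence (oddProduct n) (monic-oddProduct n) (constantCoeff-oddProduct≢0 n) (annihilates-oddProduct n) ,
  (λ p≡2 → case ℕP.*-cancelˡ-≡ n 0 2 (ℕP.suc-injective (ℕP.suc-injective p≡2)) of λ where
    refl → R≡r ε nz) ,
  λ m p≡1+2m → ⊥-elim (ℕP.even≢odd m n (sym (ℕP.suc-injective p≡1+2m)))
  where
  open SquareRoot j
  open RatioSequence (evenRatio n) ε nz
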